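{- Let $m\ge2$, $k\ge1$, let $A=\mathbb{C}\langle u_1,\dots,u_n\rangle$, let $\omega\in A$ have multiplicative order $k(m-1)$, and let $\circ$ be the $m$-ary operation on $A$ defined by $a_1\circ\dots\circ a_m=\omega^{m-1}a_1+\omega^{m-2}a_2+\dots+\omega a_{m-1}+a_m$. Then $\circ$ is $k$-associative: for every $1\le j\le m-1$ and all $a_1,\dots,a_{m+k(m-1)}\in A$, $$a_1\circ\dots\circ a_{j-1}\circ(a_j\circ\dots\circ a_{j+k(m-1)})\circ a_{j+k(m-1)+1}\circ\dots\circ a_{m+k(m-1)}=a_1\circ\dots\circ a_j\circ(a_{j+1}\circ\dots\circ a_{j+k(m-1)+1})\circ a_{j+k(m-1)+2}\circ\dots\circ a_{m+k(m-1)}.$$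
   Context: $A$ is the free unital associative $\mathbb{C}$-algebra in $u_1,\dots,u_n$. Convention (left-associativity): an unbracketed $m$-ary product $b_1\circ\dots\circ b_{m+h(m-1)}$ means $((\dots((b_1\circ\dots\circ b_m)\circ b_{m+1}\circ\dots\circ b_{2m-1})\dots)\circ\dots\circ b_{m+h(m-1)})$, repeatedly applying $\circ$ to the previous result and the next $m-1$ elements. -}

module Defs where

open import Level using (Level)
open import Algebra.Bundles using (Ring)
open import Data.Nat using (ℕ; zero; suc) renaming (_*_ to _*ℕ_; _+_ to _+ℕ_; _≤_ to _≤ℕ_; _<_ to _<ℕ_)
open import Data.Vec using (Vec; []; _∷_; splitAt; take)
open import Data.Product using (_×_; _,_)
open import Relation.Nullary using (¬_)

module _ {c ℓ : Level} (R : Ring c ℓ) where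
  open Ring R renaming (Carrier to A)

  pow : A → ℕ → A
  pow ω zero    = 1#
  pow ω (suc n) = ω * pow ω n

  HasOrder : A → ℕ → Set ℓ
  HasOrder ω n = (pow ω n ≈ 1#) × (∀ e → 1 ≤ℕ e → e <ℕ n → ¬ (pow ω e ≈ 1#))

  op : (ω : A) {m : ℕ} → Vec A m → A
  op ω []              = 0#
  op ω {suc m} (a ∷ as) = pow ω m * a + op ω as

  -- left-associated unbracketed product of m + h(m-1) elements, m = suc d:
  -- first combine the first m elements, then repeatedly combine the result
  -- with the next m-1 = d elements.
  lcomp : (ω : A) (d h : ℕ) → Vec A (suc d +ℕ h *ℕ d) → A
  lcomp ω d zero    v = op ω (take (suc d) v)
  lcomp ω d (suc h) v with splitAt (suc d) v
  ... | xs , ys , _ = lcomp ω d h (op ω xs ∷ ys)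

  -- unbracketed product of k(m-1)+1 elements (k ≥ 1), m = suc d.
  -- (k = 0 case, a single element, is never used.)
  kcomp : (ω : A) (d k : ℕ) → Vec A (suc (k *ℕ d)) → A
  kcomp ω d zero    (a ∷ []) = a
  kcomp ω d (suc k) v        = lcomp ω d k v

-- Expanding the brackets turns a₁ ∘ ⋯ ∘ aₘ into the linear form Σᵢ ω^(m−i) aᵢ,
-- and a left-associated product into the same form on its flattened argument
-- list.  The two sides therefore agree outside positions j, j+1, and there one
-- compares ω K₁ + w with ω y + K₂: writing Z for the form of z, K₁ = y + Z since
-- the weight ω^(k(m−1)) of y is 1, and K₂ = ω Z + w.  Only ω^(k(m−1)) = 1 is
-- used, not the minimality of the order.
module Submission where

open import Defs
open import Level using (Level)
open import Algebra.Bundles using (Ring)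
open import Data.Nat as ℕ using (ℕ; _*_; _∸_; _≤_; zero; suc; s≤s)
import Data.Nat.Properties as ℕ
open import Data.Vec using (Vec; _∷_; _++_; _∷ʳ_; []; splitAt)
open import Data.Product using (_,_)
open import Relation.Binary.PropositionalEquality as ≡ using (_≡_)
import Relation.Binary.Reasoning.Setoid as SetoidReasoning
import Algebra.Properties.Semiring.Exp as Exp

module LinearForm {c ℓ : Level} (R : Ring c ℓ) (ω : Ring.Carrier R) where
  open Ring R renaming (Carrier to A; _*_ to _·_)
  open Exp semiring using (_^_; ^-homo-*)
  open SetoidReasoning setoid

  pow≡^ : ∀ n → pow R ω n ≡ ω ^ n
  pow≡^ zero    = ≡.refl
  pow≡^ (suc n) = ≡.cong (ω ·_) (pow≡^ n)

  pow-homo-* : ∀ m n → pow R ω (m ℕ.+ n) ≈ pow R ω m · pow R ω n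
  pow-homo-* m n rewrite pow≡^ (m ℕ.+ n) | pow≡^ m | pow≡^ n = ^-homo-* ω m n

  op-++ : ∀ {l n} (xs : Vec A l) (ys : Vec A n) →
          op R ω (xs ++ ys) ≈ pow R ω n · op R ω xs + op R ω ys
  op-++ [] ys = sym (trans (+-congʳ (zeroʳ _)) (+-identityˡ _))
  op-++ {suc l} {n} (a ∷ xs) ys = begin
    pow R ω (l ℕ.+ n) · a + op R ω (xs ++ ys)
      ≈⟨ +-cong (*-congʳ (trans (reflexive (≡.cong (pow R ω) (ℕ.+-comm l n)))
                                (pow-homo-* n l)))
                (op-++ xs ys) ⟩
    (pow R ω n · pow R ω l) · a + (pow R ω n · op R ω xs + op R ω ys)
      ≈⟨ +-congʳ (*-assoc _ _ _) ⟩
    pow R ω n · (pow R ω l · a) + (pow R ω n · op R ω xs + op R ω ys)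
      ≈⟨ +-assoc _ _ _ ⟨
    (pow R ω n · (pow R ω l · a) + pow R ω n · op R ω xs) + op R ω ys
      ≈⟨ +-congʳ (distribˡ _ _ _) ⟨
    pow R ω n · (pow R ω l · a + op R ω xs) + op R ω ys ∎

  op-∷ʳ : ∀ {l} (z : Vec A l) w → op R ω (z ∷ʳ w) ≈ ω · op R ω z + w
  op-∷ʳ [] w = begin
    1# · w + 0#       ≈⟨ +-identityʳ _ ⟩
    1# · w            ≈⟨ *-identityˡ w ⟩
    w                 ≈⟨ +-identityˡ w ⟨
    0# + w            ≈⟨ +-congʳ (zeroʳ ω) ⟨
    ω · 0# + w        ∎
  op-∷ʳ {suc l} (a ∷ z) w = begin
    (ω · pow R ω l) · a + op R ω (z ∷ʳ w)
      ≈⟨ +-cong (*-assoc _ _ _) (op-∷ʳ z w) ⟩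
    ω · (pow R ω l · a) + (ω · op R ω z + w)
      ≈⟨ +-assoc _ _ _ ⟨
    (ω · (pow R ω l · a) + ω · op R ω z) + w
      ≈⟨ +-congʳ (distribˡ _ _ _) ⟨
    ω · (pow R ω l · a + op R ω z) + w ∎

  op-singleton : ∀ a → op R ω (a ∷ []) ≈ a
  op-singleton a = trans (+-identityʳ _) (*-identityˡ a)

  op-pair : ∀ a b → op R ω (a ∷ b ∷ []) ≈ ω · a + b
  op-pair a b = trans (op-∷ʳ (a ∷ []) b) (+-congʳ (*-congˡ (op-singleton a)))

  op-∷-periodic : ∀ {n} → pow R ω n ≈ 1# → ∀ y (z : Vec A n) →
                  op R ω (y ∷ z) ≈ y + op R ω z
  op-∷-periodic ωⁿ≈1 y z = +-congʳ (trans (*-congʳ ωⁿ≈1) (*-identityˡ y))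

  op-cong-infix : ∀ {i l n} (x : Vec A i) {u v : Vec A l} (t : Vec A n) →
                  op R ω u ≈ op R ω v → op R ω (x ++ u ++ t) ≈ op R ω (x ++ v ++ t)
  op-cong-infix {l = l} {n} x {u} {v} t u≈v = begin
    op R ω (x ++ u ++ t)
      ≈⟨ op-++ x (u ++ t) ⟩
    pow R ω (l ℕ.+ n) · op R ω x + op R ω (u ++ t)
      ≈⟨ +-congˡ (trans (op-++ u t) (+-congʳ (*-congˡ u≈v))) ⟩
    pow R ω (l ℕ.+ n) · op R ω x + (pow R ω n · op R ω v + op R ω t)
      ≈⟨ +-congˡ (op-++ v t) ⟨
    pow R ω (l ℕ.+ n) · op R ω x + op R ω (v ++ t)
      ≈⟨ op-++ x (v ++ t) ⟨
    op R ω (x ++ v ++ t) ∎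

  lcomp-flattens : ∀ d h (v : Vec A (suc d ℕ.+ h * d)) → lcomp R ω d h v ≈ op R ω v
  -- take is defined through splitAt, so this match also reduces the take in lcomp.
  lcomp-flattens d zero v with splitAt (suc d) v
  ... | xs , [] , ≡.refl = begin
    op R ω xs                         ≈⟨ *-identityˡ _ ⟨
    1# · op R ω xs                    ≈⟨ +-identityʳ _ ⟨
    1# · op R ω xs + 0#               ≈⟨ op-++ xs [] ⟨
    op R ω (xs ++ [])                 ∎
  lcomp-flattens d (suc h) v with splitAt (suc d) v
  ... | xs , ys , v≡xs++ys = begin
    lcomp R ω d h (op R ω xs ∷ ys)    ≈⟨ lcomp-flattens d h (op R ω xs ∷ ys) ⟩
    op R ω (op R ω xs ∷ ys)           ≈⟨ op-++ xs ys ⟨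
    op R ω (xs ++ ys)                 ≡⟨ ≡.cong (op R ω) v≡xs++ys ⟨
    op R ω v                          ∎

lemma4p2 : ∀ {c ℓ : Level} (R : Ring c ℓ) (m k : ℕ) → 2 ≤ m → 1 ≤ k →
    (ω : Ring.Carrier R) → HasOrder R ω (k * (m ∸ 1)) →
    (j : ℕ) → 1 ≤ j → j ≤ m ∸ 1 →
    (x : Vec (Ring.Carrier R) (j ∸ 1)) (y : Ring.Carrier R)
    (z : Vec (Ring.Carrier R) (k * (m ∸ 1))) (w : Ring.Carrier R)
    (t : Vec (Ring.Carrier R) ((m ∸ 1) ∸ j)) →
    Ring._≈_ R
      (op R ω (x ++ (kcomp R ω (m ∸ 1) k (y ∷ z) ∷ w ∷ t)))
      (op R ω (x ++ (y ∷ kcomp R ω (m ∸ 1) k (z ∷ʳ w) ∷ t)))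
lemma4p2 R (suc (suc d)) (suc k) (s≤s (s≤s _)) (s≤s _) ω (ωᴺ≈1 , _) j _ _ x y z w t =
  op-cong-infix x t window
  where
  open Ring R renaming (_*_ to _·_)
  open LinearForm R ω
  open SetoidReasoning setoid

  K₁ = lcomp R ω (suc d) k (y ∷ z)
  K₂ = lcomp R ω (suc d) k (z ∷ʳ w)

  K₁≈ : K₁ ≈ y + op R ω z
  K₁≈ = trans (lcomp-flattens (suc d) k (y ∷ z)) (op-∷-periodic ωᴺ≈1 y z)

  K₂≈ : K₂ ≈ ω · op R ω z + w
  K₂≈ = trans (lcomp-flattens (suc d) k (z ∷ʳ w)) (op-∷ʳ z w)

  window : op R ω (K₁ ∷ w ∷ []) ≈ op R ω (y ∷ K₂ ∷ [])
  window = begin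
    op R ω (K₁ ∷ w ∷ [])         ≈⟨ op-pair K₁ w ⟩
    ω · K₁ + w                   ≈⟨ +-congʳ (trans (*-congˡ K₁≈) (distribˡ _ _ _)) ⟩
    (ω · y + ω · op R ω z) + w   ≈⟨ +-assoc _ _ _ ⟩
    ω · y + (ω · op R ω z + w)   ≈⟨ +-congˡ K₂≈ ⟨
    ω · y + K₂                   ≈⟨ op-pair y K₂ ⟨
    op R ω (y ∷ K₂ ∷ [])         ∎
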